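{- Let $m,a,b$ be positive integers with $(3m+1)/2\le a<b\le(5m-1)/3$. Let $A=\{a,b\}$ and assume that the nine integers $a,\ b,\ 2a,\ a+b,\ 2b,\ 3a,\ 2a+b,\ a+2b,\ 3b$ are pairwise distinct modulo $m$. Let $S=\langle m,a,b\rangle_{4m}$. Then $W_0(S)=-1$.
   Context: A numerical semigroup is a submonoid $S\subseteq\mathbb N=\{0,1,2,\dots\}$ (containing $0$ and closed under addition) with finite complement in $\mathbb N$. Let $S^*=S\setminus\{0\}$. The multiplicity is $m=\min S^*$; the conductor $c$ is the least integer with $c+\mathbb N\subseteq S$. Set $q=\lceil c/m\rceil$ and $\rho=qm-c$. Let $P$ be the set of primitive elements of $S$ (elements of $S^*$ not expressible as $a_1+a_2$ with $a_1,a_2\in S^*$), $D=S^*+S^*$, $L=S\cap\{0,1,\dots,c-1\}$, $D_q=D\cap\{c,\dots,c+m-1\}$, and $W_0(S)=|P\cap L||L|-q|D_q|+\rho$. For positive integers $a_1,\dots,a_n,t$, $\langle a_1,\dots,a_n\rangle_t=(\mathbb N a_1+\dots+\mathbb N a_n)\cup\{z\in\mathbb Z\mid z\ge t\}$, which is always a numerical semigroup. -}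

module Defs where

open import Data.Bool using (Bool; true; false; _∧_; _∨_; not; if_then_else_)
open import Data.Nat using (ℕ; zero; suc; _+_; _*_; _∸_; _≤ᵇ_; _≡ᵇ_; NonZero)
open import Data.Nat.DivMod using (_/_)
open import Data.List using (List; []; _∷_; length; filter; upTo; map)
open import Data.Bool.ListAction using (any)
open import Data.Integer using (ℤ; _-_)
import Data.Integer
open Data.Integer using () renaming (+_ to ⁺)
import Data.Integer as ℤ
open import Data.Bool.Properties using (T?)

range : ℕ → ℕ → List ℕ
range lo n = map (lo +_) (upTo n)

-- z ∈ ℕ g₁ + … + ℕ gₖ  (decided by bounded search over the coefficient of each generator)
inMon : List ℕ → ℕ → Bool
inMon []       z = z ≡ᵇ 0
inMon (g ∷ gs) z = any (λ k → (k * g ≤ᵇ z) ∧ inMon gs (z ∸ k * g)) (upTo (suc z))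

-- membership in  ⟨ gens ⟩_t = (ℕ g₁ + … + ℕ gₖ) ∪ { z ≥ t }
mem : List ℕ → ℕ → ℕ → Bool
mem gens t z = (t ≤ᵇ z) ∨ inMon gens z

mem* : List ℕ → ℕ → ℕ → Bool
mem* gens t z = not (z ≡ᵇ 0) ∧ mem gens t z

-- multiplicity m = min S*  (searched in 1..t; t ∈ S* whenever t ≥ 1)
multSearch : (ℕ → Bool) → ℕ → ℕ → ℕ
multSearch p zero    z = z
multSearch p (suc f) z = if p z then z else multSearch p f (suc z)

multiplicity : List ℕ → ℕ → ℕ
multiplicity gens t = multSearch (mem* gens t) t 1

-- conductor c = least c with c + ℕ ⊆ S.  Since every z ≥ t lies in S,
-- c is the least c ≤ t with [c, t) ⊆ S; found by walking down from t.
condSearch : (ℕ → Bool) → ℕ → ℕ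
condSearch p zero    = zero
condSearch p (suc k) = if p k then condSearch p k else suc k

conductor : List ℕ → ℕ → ℕ
conductor gens t = condSearch (mem gens t) t

inD : List ℕ → ℕ → ℕ → Bool
inD gens t z = any (λ x → mem* gens t x ∧ mem* gens t (z ∸ x)) (range 1 z)

isPrimitive : List ℕ → ℕ → ℕ → Bool
isPrimitive gens t z = mem* gens t z ∧ not (inD gens t z)

-- ⌈ x / y ⌉ for y ≠ 0 (the y = 0 case never arises: the multiplicity is positive)
ceilDiv : ℕ → ℕ → ℕ
ceilDiv x zero    = zero
ceilDiv x (suc y) = (x + y) / suc y

W0 : List ℕ → ℕ → ℤ
W0 gens t = (⁺ (nPL * nL) - ⁺ (q * nDq)) ℤ.+ ⁺ ρ
  where
  m   = multiplicity gens t
  c   = conductor gens t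
  L   = filter (λ z → T? (mem gens t z)) (upTo c)
  nL  = length L
  nPL = length (filter (λ z → T? (isPrimitive gens t z)) L)
  nDq = length (filter (λ z → T? (inD gens t z)) (range c m))
  q   = ceilDiv c m
  ρ   = q * m ∸ c

module Submission where

-- Write S = ⟨m, a, b⟩₄ₘ.  Every element of S below 5m is a value
-- val(i, j, k) = i m + j a + k b, and since 3m < 2a < 2b and 3b < 5m the
-- "weight" 2i + 3(j + k) of a triple decides where its value lies:
-- weight ≤ 7 gives the 13 elements of L = S ∩ [0, 4m), weight 8 or 9 the 10
-- elements of D ∩ [4m, 5m), and among the elements of L exactly the three of
-- degree i + j + k = 1 (namely m, a, b) are primitive.  Hence c = 4m (as
-- 4m - 1 ∉ S), multiplicity m, q = 4, ρ = 0 and W₀ = 3·13 - 4·10 + 0 = -1.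
--
-- The hypothesis on residues is needed only to exclude 3a = 3m + b,
-- which would merge two elements of D_q.

open import Defs
open import Data.Nat using (ℕ; _+_; _*_; _<_; _≤_; NonZero)
open import Data.Nat.DivMod using (_%_)
open import Data.List using (List; []; _∷_; map)
open import Data.List.Relation.Unary.Unique.Propositional using (Unique)
open import Data.Integer using (-[1+_])
open import Relation.Binary.PropositionalEquality using (_≡_)

open import Data.Nat using (zero; suc; _∸_; _≤?_; _≟_; z≤n; s≤s; s≤s⁻¹)
open import Data.Nat.Properties
open import Data.Nat.DivMod using (_/_; m*n/n≡m; m<n⇒m/n≡0; +-distrib-/-∣ˡ; [m+kn]%n≡m%n)
open import Data.Nat.Divisibility using (divides-refl)
open import Data.Nat.Tactic.RingSolver using (solve)
open import Data.Bool using (Bool; true; false; T; not)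
open import Data.Bool.Properties using (T?; T-∧; T-∨; T-≡; T-not-≡)
open import Data.List using (filter; upTo; length)
open import Data.Integer using (_-_) renaming (+_ to ⁺)
import Data.Integer as ℤ
open import Data.List.Membership.Propositional using (_∈_; find; lose)
open import Data.List.Membership.Propositional.Properties
  using (∈-map⁺; ∈-map⁻; ∈-upTo⁺; ∈-upTo⁻; ∈-filter⁺; ∈-filter⁻)
open import Data.List.Relation.Unary.All as All using (All; all?) renaming (_∷_ to _∷ᴬ_)
open import Data.List.Relation.Unary.Any using (here; there)
open import Data.List.Relation.Unary.Any.Properties using (any⁺; any⁻)
open import Data.List.Relation.Unary.AllPairs using (AllPairs) renaming ([] to []ᴾ; _∷_ to _∷ᴾ_)
import Data.List.Relation.Unary.AllPairs as AllPairs
import Data.List.Relation.Unary.AllPairs.Properties as AllPairs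
open import Data.List.Relation.Binary.Permutation.Propositional using (_↭_; prep; swap; ↭-refl; ↭-sym)
open import Data.List.Relation.Binary.Permutation.Propositional.Properties using (∈-resp-↭)
open import Data.Product using (Σ; ∃₂; _×_; _,_; proj₁; proj₂)
open import Data.Product.Properties using (≡-dec)
open import Data.Sum using (_⊎_; inj₁; inj₂; [_,_]′)
open import Data.Empty using (⊥-elim)
open import Function using (_∘_; Equivalence)
open import Relation.Nullary using (¬_; Dec)
open import Relation.Nullary.Decidable using (toWitness; _→-dec_; _⊎-dec_)
open import Relation.Unary using (Decidable)
open import Relation.Binary using (DecidableEquality; tri<; tri≈; tri>)
open import Relation.Binary.PropositionalEquality
  using (_≢_; refl; sym; trans; cong; cong₂; subst; subst₂; module ≡-Reasoning)

Increasing : List ℕ → Set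
Increasing = AllPairs _<_

heads-equal : ∀ {x y xs ys} → All (x <_) xs → All (y <_) ys → x ∈ y ∷ ys → y ∈ x ∷ xs → x ≡ y
heads-equal _ _ (here x≡y) _ = x≡y
heads-equal _ _ _ (here y≡x) = sym y≡x
heads-equal x<xs y<ys (there x∈ys) (there y∈xs) =
  ⊥-elim (<-asym (All.lookup x<xs y∈xs) (All.lookup y<ys x∈ys))

increasing-unique : ∀ {xs ys} → Increasing xs → Increasing ys →
  (∀ {z} → z ∈ xs → z ∈ ys) → (∀ {z} → z ∈ ys → z ∈ xs) → xs ≡ ys
increasing-unique {[]} {[]} _ _ _ _ = refl
increasing-unique {[]} {_ ∷ _} _ _ _ ys⊆xs with () ← ys⊆xs (here refl)
increasing-unique {_ ∷ _} {[]} _ _ xs⊆ys _ with () ← xs⊆ys (here refl)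
increasing-unique {x ∷ xs} {y ∷ ys} (x<xs ∷ᴾ ↑xs) (y<ys ∷ᴾ ↑ys) xs⊆ys ys⊆xs
  with refl ← heads-equal x<xs y<ys (xs⊆ys (here refl)) (ys⊆xs (here refl))
  = cong (x ∷_) (increasing-unique ↑xs ↑ys
      (λ z∈xs → drop-head (All.lookup x<xs z∈xs) (xs⊆ys (there z∈xs)))
      (λ z∈ys → drop-head (All.lookup y<ys z∈ys) (ys⊆xs (there z∈ys))))
  where
  drop-head : ∀ {h z zs} → h < z → z ∈ h ∷ zs → z ∈ zs
  drop-head h<z (here refl) = ⊥-elim (<-irrefl refl h<z)
  drop-head _ (there z∈zs) = z∈zs

-- Filtering an increasing list gives the increasing list of its members
-- satisfying P.  Every count in W₀ is computed this way: it suffices to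
-- exhibit the expected increasing list E and to check membership both ways.
filter-increasing : ∀ {P : ℕ → Set} (P? : Decidable P) {xs E} → Increasing xs → Increasing E →
  (∀ {z} → z ∈ xs → P z → z ∈ E) → (∀ {z} → z ∈ E → z ∈ xs × P z) → filter P? xs ≡ E
filter-increasing P? ↑xs ↑E complete sound =
  increasing-unique (AllPairs.filter⁺ P? ↑xs) ↑E
    (λ z∈f → let z∈xs , Pz = ∈-filter⁻ P? z∈f in complete z∈xs Pz)
    (λ z∈E → let z∈xs , Pz = sound z∈E in ∈-filter⁺ P? z∈xs Pz)

upTo-increasing : ∀ n → Increasing (upTo n)
upTo-increasing n = AllPairs.applyUpTo⁺₁ (λ i → i) n (λ i<j _ → i<j)

range-increasing : ∀ lo n → Increasing (range lo n)
range-increasing lo n = AllPairs.map⁺ (AllPairs.map (+-monoʳ-< lo) (upTo-increasing n))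

∈-range⁺ : ∀ {lo n z} → lo ≤ z → z < lo + n → z ∈ range lo n
∈-range⁺ {lo} {n} {z} lo≤z z<lo+n = subst (_∈ range lo n) (m+[n∸m]≡n lo≤z)
  (∈-map⁺ (lo +_) (∈-upTo⁺ (+-cancelˡ-< lo _ _ (subst (_< lo + n) (sym (m+[n∸m]≡n lo≤z)) z<lo+n))))

∈-range⁻ : ∀ {lo n z} → z ∈ range lo n → lo ≤ z × z < lo + n
∈-range⁻ {lo} z∈ with i , i∈ , refl ← ∈-map⁻ (lo +_) z∈ =
  m≤m+n lo i , +-monoʳ-< lo (∈-upTo⁻ i∈)

data Chain : ℕ → ℕ → List ℕ → Set where
  end  : ∀ {lo hi} → lo ≤ hi → Chain lo hi []
  _∷ᶜ_ : ∀ {lo hi e E} → lo ≤ e → Chain (suc e) hi E → Chain lo hi (e ∷ E)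

infixr 5 _∷ᶜ_

chain-lo≤hi : ∀ {lo hi E} → Chain lo hi E → lo ≤ hi
chain-lo≤hi (end lo≤hi) = lo≤hi
chain-lo≤hi (lo≤e ∷ᶜ c) = ≤-trans lo≤e (<⇒≤ (chain-lo≤hi c))

chain-bounds : ∀ {lo hi E z} → Chain lo hi E → z ∈ E → lo ≤ z × z < hi
chain-bounds (lo≤e ∷ᶜ c) (here refl) = lo≤e , chain-lo≤hi c
chain-bounds (lo≤e ∷ᶜ c) (there z∈E) with e<z , z<hi ← chain-bounds c z∈E =
  ≤-trans lo≤e (<⇒≤ e<z) , z<hi

chain-increasing : ∀ {lo hi E} → Chain lo hi E → Increasing E
chain-increasing (end _) = []ᴾ
chain-increasing (_ ∷ᶜ c) = All.tabulate (λ z∈E → proj₁ (chain-bounds c z∈E)) ∷ᴾ chain-increasing c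

data Generated : List ℕ → ℕ → Set where
  nil  : Generated [] 0
  cons : ∀ {g gs z} k → Generated gs z → Generated (g ∷ gs) (k * g + z)

inMon-step : ∀ g gs z k → k * g ≤ z → k ≤ z → T (inMon gs (z ∸ k * g)) → T (inMon (g ∷ gs) z)
inMon-step g gs z k kg≤z k≤z rest =
  any⁺ _ (lose (∈-upTo⁺ (s≤s k≤z)) (Equivalence.from T-∧ (≤⇒≤ᵇ kg≤z , rest)))

inMon-sound : ∀ gs z → T (inMon gs z) → Generated gs z
inMon-sound [] z z≡0 with refl ← ≡ᵇ⇒≡ z 0 z≡0 = nil
inMon-sound (g ∷ gs) z h with k , _ , hk ← find (any⁻ _ (upTo (suc z)) h)
  with kg≤z , rest ← Equivalence.to T-∧ hk =
  subst (Generated (g ∷ gs)) (m+[n∸m]≡n (≤ᵇ⇒≤ (k * g) z kg≤z)) (cons k (inMon-sound gs _ rest))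

-- (The search finds every combination: a zero generator is given coefficient 0.)
inMon-complete : ∀ {gs z} → Generated gs z → T (inMon gs z)
inMon-complete nil = _
inMon-complete (cons {zero} {gs} {z} k p) =
  subst (T ∘ inMon (0 ∷ gs)) (sym (cong (_+ z) (*-zeroʳ k)))
    (inMon-step 0 gs z 0 z≤n z≤n (inMon-complete p))
inMon-complete (cons {suc g} {gs} {z} k p) =
  inMon-step (suc g) gs (k * suc g + z) k (m≤m+n _ z)
    (≤-trans (m≤m*n k (suc g)) (m≤m+n _ z))
    (subst (T ∘ inMon gs) (sym (m+n∸m≡n (k * suc g) z)) (inMon-complete p))

module _ (gens : List ℕ) (t : ℕ) where

  mem-generated : ∀ {z} → Generated gens z → T (mem gens t z)
  mem-generated p = Equivalence.from T-∨ (inj₂ (inMon-complete p))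

  mem-below : ∀ {z} → z < t → T (mem gens t z) → Generated gens z
  mem-below {z} z<t z∈S with Equivalence.to T-∨ z∈S
  ... | inj₁ t≤z = ⊥-elim (<-irrefl refl (≤-<-trans (≤ᵇ⇒≤ t z t≤z) z<t))
  ... | inj₂ p = inMon-sound gens z p

  mem*-intro : ∀ {z} → 0 < z → T (mem gens t z) → T (mem* gens t z)
  mem*-intro {suc _} _ z∈S = z∈S

  mem*-elim : ∀ {z} → T (mem* gens t z) → 0 < z × T (mem gens t z)
  mem*-elim {suc _} z∈S = s≤s z≤n , z∈S

  inD-sound : ∀ {z} → T (inD gens t z) →
    ∃₂ λ x y → T (mem* gens t x) × T (mem* gens t y) × x + y ≡ z
  inD-sound {z} h with x , x∈ , hx ← find (any⁻ _ (range 1 z) h)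
    with x∈S* , y∈S* ← Equivalence.to T-∧ hx =
    x , z ∸ x , x∈S* , y∈S* , m+[n∸m]≡n (s≤s⁻¹ (proj₂ (∈-range⁻ x∈)))

  inD-complete : ∀ {x y} → T (mem* gens t x) → T (mem* gens t y) → T (inD gens t (x + y))
  inD-complete {x} {y} x∈S* y∈S* =
    any⁺ _ (lose (∈-range⁺ (proj₁ (mem*-elim x∈S*)) (s≤s (m≤m+n x y)))
      (Equivalence.from T-∧ (x∈S* , subst (T ∘ mem* gens t) (sym (m+n∸m≡n x y)) y∈S*)))

conductor-of : ∀ gens t → 0 < t → ¬ T (mem gens t (t ∸ 1)) → conductor gens t ≡ t
conductor-of gens (suc k) _ k∉S with mem gens (suc k) k
... | false = refl
... | true = ⊥-elim (k∉S _)

multSearch-first : ∀ (p : ℕ → Bool) f z w → z ≤ w → w < z + f →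
  (∀ i → z ≤ i → i < w → p i ≡ false) → p w ≡ true → multSearch p f z ≡ w
multSearch-first p zero z w z≤w w<z+0 _ _ =
  ⊥-elim (<-irrefl refl (≤-<-trans z≤w (subst (w <_) (+-identityʳ z) w<z+0)))
multSearch-first p (suc f) z w z≤w w<z+f miss hit with m≤n⇒m<n∨m≡n z≤w
... | inj₂ refl rewrite hit = refl
... | inj₁ z<w rewrite miss z ≤-refl z<w =
  multSearch-first p f (suc z) w z<w (subst (w <_) (+-suc z f) w<z+f)
    (λ i z<i → miss i (<⇒≤ z<i)) hit

W0-from-counts : ∀ gens t {c μ nPL nL nDq} →
  conductor gens t ≡ c → multiplicity gens t ≡ μ →
  length (filter (T? ∘ isPrimitive gens t) (filter (T? ∘ mem gens t) (upTo c))) ≡ nPL →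
  length (filter (T? ∘ mem gens t) (upTo c)) ≡ nL →
  length (filter (T? ∘ inD gens t) (range c μ)) ≡ nDq →
  W0 gens t ≡ (⁺ (nPL * nL) - ⁺ (ceilDiv c μ * nDq)) ℤ.+ ⁺ (ceilDiv c μ * μ ∸ c)
W0-from-counts gens t refl refl refl refl refl = refl

ceilDiv-multiple : ∀ k n → .{{NonZero n}} → ceilDiv (k * n) n ≡ k
ceilDiv-multiple k (suc n) = begin
  (k * suc n + n) / suc n           ≡⟨ +-distrib-/-∣ˡ n (divides-refl k) ⟩
  k * suc n / suc n + n / suc n     ≡⟨ cong₂ _+_ (m*n/n≡m k (suc n)) (m<n⇒m/n≡0 ≤-refl) ⟩
  k + 0                             ≡⟨ +-identityʳ k ⟩
  k                                 ∎
  where open ≡-Reasoning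

-- Coefficient triples (i, j, k), standing for i m + j a + k b.  Everything
-- about them that does not involve m, a, b is decided by evaluation.
Triple : Set
Triple = ℕ × ℕ × ℕ

_⊕_ : Triple → Triple → Triple
(i , j , k) ⊕ (i′ , j′ , k′) = (i + i′ , j + j′ , k + k′)

_≟ᵗ_ : DecidableEquality Triple
_≟ᵗ_ = ≡-dec _≟_ (≡-dec _≟_ _≟_)

open import Data.List.Membership.DecPropositional _≟ᵗ_ using (_∈?_)

-- Since 3m < 2a < 2b, the weight 2i + 3(j + k) controls the size of a value
-- (in units of m/2); the degree i + j + k is its number of summands.
weight : Triple → ℕ
weight (i , j , k) = 2 * i + 3 * (j + k)

degree : Triple → ℕ
degree (i , j , k) = i + j + k

-- The triples of weight ≤ 7, by increasing value (values below 4m).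
lowTriples : List Triple
lowTriples = (0 , 0 , 0) ∷ (1 , 0 , 0) ∷ (0 , 1 , 0) ∷ (0 , 0 , 1) ∷ (2 , 0 , 0) ∷ (1 , 1 , 0) ∷
  (1 , 0 , 1) ∷ (3 , 0 , 0) ∷ (0 , 2 , 0) ∷ (0 , 1 , 1) ∷ (0 , 0 , 2) ∷ (2 , 1 , 0) ∷ (2 , 0 , 1) ∷ []

-- The triples of weight 8 or 9 (values in [4m, 5m)), by increasing value when
-- 3a < 3m + b; heavyTriples′ swaps (0,3,0) and (3,0,1) for 3m + b < 3a.
heavyTriples heavyTriples′ : List Triple
heavyTriples = (4 , 0 , 0) ∷ (1 , 2 , 0) ∷ (1 , 1 , 1) ∷ (1 , 0 , 2) ∷ (3 , 1 , 0) ∷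
  (0 , 3 , 0) ∷ (3 , 0 , 1) ∷ (0 , 2 , 1) ∷ (0 , 1 , 2) ∷ (0 , 0 , 3) ∷ []
heavyTriples′ = (4 , 0 , 0) ∷ (1 , 2 , 0) ∷ (1 , 1 , 1) ∷ (1 , 0 , 2) ∷ (3 , 1 , 0) ∷
  (3 , 0 , 1) ∷ (0 , 3 , 0) ∷ (0 , 2 , 1) ∷ (0 , 1 , 2) ∷ (0 , 0 , 3) ∷ []

heavy↭heavy′ : heavyTriples ↭ heavyTriples′
heavy↭heavy′ = prep _ (prep _ (prep _ (prep _ (prep _ (swap _ _ ↭-refl)))))

generatorTriples : List Triple
generatorTriples = (1 , 0 , 0) ∷ (0 , 1 , 0) ∷ (0 , 0 , 1) ∷ []

-- Weight ≤ 9 confines a triple to the box [0,5) × [0,4) × [0,4), where any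
-- decidable property can be checked by evaluation.
InBox : (Triple → Set) → Set
InBox P = ∀ {i} → i < 5 → ∀ {j} → j < 4 → ∀ {k} → k < 4 → P (i , j , k)

box? : {P : Triple → Set} → (∀ t → Dec (P t)) → Dec (InBox P)
box? P? = allUpTo? (λ i → allUpTo? (λ j → allUpTo? (λ k → P? (i , j , k)) 4) 4) 5

weight≤9⇒box : ∀ {i j k} → weight (i , j , k) ≤ 9 → i < 5 × j < 4 × k < 4
weight≤9⇒box {i} {j} {k} w≤9 =
  *-cancelˡ-< 2 i 5 (≤-<-trans (m≤m+n (2 * i) _) (s≤s w≤9)) ,
  *-cancelˡ-< 3 j 4 (≤-<-trans (≤-trans (*-monoʳ-≤ 3 (m≤m+n j k)) 3[j+k]≤w) w<12) ,
  *-cancelˡ-< 3 k 4 (≤-<-trans (≤-trans (*-monoʳ-≤ 3 (m≤n+m k j)) 3[j+k]≤w) w<12)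
  where
  3[j+k]≤w : 3 * (j + k) ≤ weight (i , j , k)
  3[j+k]≤w = m≤n+m _ (2 * i)
  w<12 : weight (i , j , k) < 12
  w<12 = s≤s (≤-trans w≤9 (m≤m+n 9 2))

light-complete : ∀ t → weight t ≤ 7 → t ∈ lowTriples
light-complete (i , j , k) w≤7 with i<5 , j<4 , k<4 ← weight≤9⇒box {i} {j} {k} (≤-trans w≤7 (m≤m+n 7 2)) =
  toWitness {a? = box? (λ t → weight t ≤? 7 →-dec t ∈? lowTriples)} _ i<5 j<4 k<4 w≤7

light-or-heavy : ∀ t → weight t ≤ 9 → t ∈ lowTriples ⊎ t ∈ heavyTriples
light-or-heavy (i , j , k) w≤9 with i<5 , j<4 , k<4 ← weight≤9⇒box {i} {j} {k} w≤9 =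
  toWitness {a? = box? (λ t → weight t ≤? 9 →-dec (t ∈? lowTriples ⊎-dec t ∈? heavyTriples))}
    _ i<5 j<4 k<4 w≤9

heavy-degree : All (λ t → 2 ≤ degree t) heavyTriples
heavy-degree = toWitness {a? = all? (λ t → 2 ≤? degree t) heavyTriples} _

light-generators : All (λ t → degree t ≡ 1 → t ∈ generatorTriples) lowTriples
light-generators = toWitness {a? = all? (λ t → degree t ≟ 1 →-dec t ∈? generatorTriples) lowTriples} _

≤-by : ∀ {x y p q} → p ≤ q → x ≡ p → q ≡ y → x ≤ y
≤-by p≤q refl refl = p≤q

-- Monotonicity of + and * with plainly stated types (as the ring solver reads them).
+-monoˡ : ∀ {x y} z → x ≤ y → x + z ≤ y + z
+-monoˡ z = +-monoˡ-≤ z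
+-monoʳ : ∀ {x y} z → x ≤ y → z + x ≤ z + y
+-monoʳ z = +-monoʳ-≤ z
*-monoʳ : ∀ {x y} z → x ≤ y → z * x ≤ z * y
*-monoʳ z = *-monoʳ-≤ z

¬T⇒≡false : ∀ {b} → ¬ T b → b ≡ false
¬T⇒≡false {false} _ = refl
¬T⇒≡false {true} ¬b = ⊥-elim (¬b _)

module Semigroup (m a b : ℕ) (3m<2a : 3 * m + 1 ≤ 2 * a) (a<b : a < b) (3b<5m : 3 * b + 1 ≤ 5 * m) where

  gens : List ℕ
  gens = m ∷ a ∷ b ∷ []

  -- the variables for the ring solver
  vars : List ℕ
  vars = m ∷ a ∷ b ∷ []

  S S* D Prim : ℕ → Bool
  S = mem gens (4 * m)
  S* = mem* gens (4 * m)
  D = inD gens (4 * m)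
  Prim = isPrimitive gens (4 * m)

  -- Numerical consequences of the hypotheses; 11 ≤ m comes from
  -- 9m + 9 ≤ 6b ≤ 10m - 2.
  11≤m : 11 ≤ m
  11≤m = +-cancelˡ-≤ (9 * m) 11 m (≤-by chain (solve vars) (solve vars))
    where
    chain : 3 * (3 * m + 1) + 8 ≤ 2 * (5 * m)
    chain = ≤-trans (+-monoˡ 8 (*-monoʳ 3 3m<2a))
             (≤-trans (≤-by (+-monoˡ 2 (*-monoʳ 6 a<b)) (solve vars) refl)
               (≤-by (*-monoʳ 2 3b<5m) (solve vars) refl))

  0<m : 0 < m
  0<m = ≤-trans (s≤s z≤n) 11≤m

  m<a : m < a
  m<a = *-cancelˡ-< 2 m a (≤-trans 2m<3m+1 3m<2a)
    where
    2m<3m+1 : 2 * m < 3 * m + 1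
    2m<3m+1 = ≤-by (+-monoʳ (2 * m + 1) (z≤n {m})) (solve vars) (solve vars)

  b+2≤2m : b + 2 ≤ 2 * m
  b+2≤2m = *-cancelˡ-≤ 3 (≤-by (+-mono-≤ 3b<5m 5≤m) (solve vars) (solve vars))
    where
    5≤m : 5 ≤ m
    5≤m = ≤-trans (s≤s (s≤s (s≤s (s≤s (s≤s z≤n))))) 11≤m

  b<2m : b < 2 * m
  b<2m = ≤-trans (≤-by (n≤1+n (suc b)) refl (+-comm 2 b)) b+2≤2m

  2b<2m+a : 2 * b < 2 * m + a
  2b<2m+a = *-cancelˡ-≤ 6 (+-cancelˡ-≤ (9 * m + 1) _ _ step)
    where
    step : 9 * m + 1 + 6 * (1 + 2 * b) ≤ 9 * m + 1 + 6 * (2 * m + a)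
    step = ≤-trans (≤-by (+-mono-≤ (*-monoʳ 4 3b<5m) (*-monoʳ 3 3m<2a)) (solve vars) refl)
             (≤-by (m≤m+n (4 * (5 * m) + 3 * (2 * a)) (m + 1)) refl (solve vars))

  3m≤2a : 3 * m ≤ 2 * a
  3m≤2a = ≤-trans (m≤m+n (3 * m) 1) 3m<2a

  3m≤2b : 3 * m ≤ 2 * b
  3m≤2b = ≤-trans 3m≤2a (*-monoʳ 2 (<⇒≤ a<b))

  val : Triple → ℕ
  val (i , j , k) = i * m + (j * a + (k * b + 0))

  val-generated : ∀ u → Generated gens (val u)
  val-generated (i , j , k) = cons i (cons j (cons k nil))

  triple-of : ∀ {z} → Generated gens z → Σ Triple λ u → val u ≡ z
  triple-of (cons i (cons j (cons k nil))) = (i , j , k) , refl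

  val-⊕ : ∀ u v → val u + val v ≡ val (u ⊕ v)
  val-⊕ (i , j , k) (i′ , j′ , k′) = sum-identity
    where
    sum-identity : (i * m + (j * a + (k * b + 0))) + (i′ * m + (j′ * a + (k′ * b + 0)))
                   ≡ (i + i′) * m + ((j + j′) * a + ((k + k′) * b + 0))
    sum-identity = solve (i ∷ j ∷ k ∷ i′ ∷ j′ ∷ k′ ∷ m ∷ a ∷ b ∷ [])

  degree-lower : ∀ u → degree u * m ≤ val u
  degree-lower (i , j , k) = bound
    where
    bound : (i + j + k) * m ≤ i * m + (j * a + (k * b + 0))
    bound = ≤-by (+-monoʳ (i * m) (+-mono-≤ (*-monoʳ j (<⇒≤ m<a)) (*-monoʳ k (<⇒≤ (<-trans m<a a<b)))))
              (solve (i ∷ j ∷ k ∷ m ∷ [])) (solve (i ∷ j ∷ k ∷ m ∷ a ∷ b ∷ []))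

  degree-upper : ∀ u → val u ≤ degree u * b
  degree-upper (i , j , k) = bound
    where
    bound : i * m + (j * a + (k * b + 0)) ≤ (i + j + k) * b
    bound = ≤-by (+-mono-≤ (*-monoʳ i (<⇒≤ (<-trans m<a a<b))) (+-monoˡ (k * b) (*-monoʳ j (<⇒≤ a<b))))
              (solve (i ∷ j ∷ k ∷ m ∷ a ∷ b ∷ [])) (solve (i ∷ j ∷ k ∷ b ∷ []))

  weight-lower : ∀ u → weight u * m ≤ 2 * val u
  weight-lower (i , j , k) = bound
    where
    bound : (2 * i + 3 * (j + k)) * m ≤ 2 * (i * m + (j * a + (k * b + 0)))
    bound = ≤-by (+-monoʳ (2 * i * m) (+-mono-≤ (*-monoʳ j 3m≤2a) (*-monoʳ k 3m≤2b)))
              (solve (i ∷ j ∷ k ∷ m ∷ [])) (solve (i ∷ j ∷ k ∷ m ∷ a ∷ b ∷ []))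

  positive-degree : ∀ u → 0 < val u → 0 < degree u
  positive-degree u 0<val with degree u | degree-upper u
  ... | zero  | val≤0 = ⊥-elim (<-irrefl refl (<-≤-trans 0<val val≤0))
  ... | suc _ | _     = s≤s z≤n

  m≤val : ∀ u → 0 < degree u → m ≤ val u
  m≤val u 0<deg = ≤-trans (≤-by (*-monoˡ-≤ m 0<deg) (sym (+-identityʳ m)) refl) (degree-lower u)

  val∈S* : ∀ u → 0 < degree u → T (S* (val u))
  val∈S* u 0<deg = mem*-intro gens (4 * m) (<-≤-trans 0<m (m≤val u 0<deg))
    (mem-generated gens (4 * m) (val-generated u))

  S-below-4m : ∀ {z} → z < 4 * m → T (S z) → Σ Triple λ u → val u ≡ z
  S-below-4m z<4m z∈S = triple-of (mem-below gens (4 * m) z<4m z∈S)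

  S*-≥m : ∀ {z} → T (S* z) → m ≤ z
  S*-≥m {z} z∈S* with 0<z , z∈S ← mem*-elim gens (4 * m) z∈S* with <-≤-connex z (4 * m)
  ... | inj₂ 4m≤z = ≤-trans (m≤m+n m (3 * m)) 4m≤z
  ... | inj₁ z<4m with u , val≡z ← S-below-4m z<4m z∈S =
    subst (m ≤_) val≡z (m≤val u (positive-degree u (subst (0 <_) (sym val≡z) 0<z)))

  D-≥2m : ∀ {z} → T (D z) → 2 * m ≤ z
  D-≥2m z∈D with x , y , x∈S* , y∈S* , x+y≡z ← inD-sound gens (4 * m) z∈D =
    subst₂ _≤_ (cong (m +_) (sym (+-identityʳ m))) x+y≡z (+-mono-≤ (S*-≥m x∈S*) (S*-≥m y∈S*))

  D-sum : ∀ u v → 0 < degree u → 0 < degree v → T (D (val (u ⊕ v)))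
  D-sum u v 0<deg-u 0<deg-v =
    subst (T ∘ D) (val-⊕ u v) (inD-complete gens (4 * m) (val∈S* u 0<deg-u) (val∈S* v 0<deg-v))

  degree≥2⇒D : ∀ u → 2 ≤ degree u → T (D (val u))
  degree≥2⇒D (suc i , j , k) (s≤s 1≤deg) = D-sum (1 , 0 , 0) (i , j , k) (s≤s z≤n) 1≤deg
  degree≥2⇒D (zero , suc j , k) (s≤s 1≤deg) = D-sum (0 , 1 , 0) (0 , j , k) (s≤s z≤n) 1≤deg
  degree≥2⇒D (zero , zero , suc k) (s≤s 1≤deg) = D-sum (0 , 0 , 1) (0 , 0 , k) (s≤s z≤n) 1≤deg

  weight-bound : ∀ u n → val u < n * m → weight u < 2 * n
  weight-bound u n val<nm = *-cancelʳ-< m (weight u) (2 * n)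
    (≤-<-trans (weight-lower u) (subst (2 * val u <_) (sym (*-assoc 2 n m)) (*-monoʳ-< 2 val<nm)))

  val-plain : ∀ i j k → val (i , j , k) ≡ i * m + (j * a + k * b)
  val-plain i j k = cong (λ x → i * m + (j * a + x)) (+-identityʳ (k * b))

  below : ∀ i j k {h} → i * m + (j * a + k * b) < h → val (i , j , k) < h
  below i j k {h} = subst (_< h) (sym (val-plain i j k))

  compare-plain : ∀ i j k i′ j′ k′ → i * m + (j * a + k * b) < i′ * m + (j′ * a + k′ * b) →
    val (i , j , k) < val (i′ , j′ , k′)
  compare-plain i j k i′ j′ k′ = subst (val (i , j , k) <_) (sym (val-plain i′ j′ k′)) ∘ below i j k

  shift : ∀ u {v w} → val v < val w → val (u ⊕ v) < val (u ⊕ w)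
  shift u {v} {w} v<w = subst₂ _<_ (val-⊕ u v) (val-⊕ u w) (+-monoʳ-< (val u) v<w)

  -- The elementary comparisons from which all orderings of values follow,
  -- stated after adding an arbitrary triple u.
  0<m-at : ∀ u → val (u ⊕ (0 , 0 , 0)) < val (u ⊕ (1 , 0 , 0))
  0<m-at u = shift u (compare-plain 0 0 0 1 0 0 (≤-by 0<m refl (solve vars)))
  m<a-at : ∀ u → val (u ⊕ (1 , 0 , 0)) < val (u ⊕ (0 , 1 , 0))
  m<a-at u = shift u (compare-plain 1 0 0 0 1 0 (≤-by m<a (solve vars) (solve vars)))
  a<b-at : ∀ u → val (u ⊕ (0 , 1 , 0)) < val (u ⊕ (0 , 0 , 1))
  a<b-at u = shift u (compare-plain 0 1 0 0 0 1 (≤-by a<b (solve vars) (solve vars)))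
  b<2m-at : ∀ u → val (u ⊕ (0 , 0 , 1)) < val (u ⊕ (2 , 0 , 0))
  b<2m-at u = shift u (compare-plain 0 0 1 2 0 0 (≤-by b<2m (solve vars) (solve vars)))
  3m<2a-at : ∀ u → val (u ⊕ (3 , 0 , 0)) < val (u ⊕ (0 , 2 , 0))
  3m<2a-at u = shift u (compare-plain 3 0 0 0 2 0 (≤-by 3m<2a (solve vars) (solve vars)))
  2b<2m+a-at : ∀ u → val (u ⊕ (0 , 0 , 2)) < val (u ⊕ (2 , 1 , 0))
  2b<2m+a-at u = shift u (compare-plain 0 0 2 2 1 0 (≤-by 2b<2m+a (solve vars) (solve vars)))

  low-chain : Chain 0 (4 * m ∸ 1) (map val lowTriples)
  low-chain =
    z≤n ∷ᶜ
    0<m-at (0 , 0 , 0) ∷ᶜ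
    m<a-at (0 , 0 , 0) ∷ᶜ
    a<b-at (0 , 0 , 0) ∷ᶜ
    b<2m-at (0 , 0 , 0) ∷ᶜ
    m<a-at (1 , 0 , 0) ∷ᶜ
    a<b-at (1 , 0 , 0) ∷ᶜ
    b<2m-at (1 , 0 , 0) ∷ᶜ
    3m<2a-at (0 , 0 , 0) ∷ᶜ
    a<b-at (0 , 1 , 0) ∷ᶜ
    a<b-at (0 , 0 , 1) ∷ᶜ
    2b<2m+a-at (0 , 0 , 0) ∷ᶜ
    a<b-at (2 , 0 , 0) ∷ᶜ
    end (below 2 0 1 2m+b<4m-1)
    where
    2m+b<4m-1 : 2 * m + (0 * a + 1 * b) < 4 * m ∸ 1
    2m+b<4m-1 = m+n≤o⇒m≤o∸n (suc (2 * m + (0 * a + 1 * b))) {1} {4 * m}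
      (≤-by (+-monoʳ (2 * m) b+2≤2m) (solve vars) (solve vars))

  -- Between 4m and 5m lie ten values of triples; their order depends only on
  -- how 3a compares with 3m + b.
  heavy-chain : 3 * a < 3 * m + b → Chain (4 * m) (5 * m) (map val heavyTriples)
  heavy-chain 3a<3m+b =
    subst (4 * m ≤_) (sym (val-plain 4 0 0)) (≤-reflexive (solve vars)) ∷ᶜ
    3m<2a-at (1 , 0 , 0) ∷ᶜ
    a<b-at (1 , 1 , 0) ∷ᶜ
    a<b-at (1 , 0 , 1) ∷ᶜ
    2b<2m+a-at (1 , 0 , 0) ∷ᶜ
    3m<2a-at (0 , 1 , 0) ∷ᶜ
    compare-plain 0 3 0 3 0 1 (≤-by 3a<3m+b (solve vars) (solve vars)) ∷ᶜ
    3m<2a-at (0 , 0 , 1) ∷ᶜ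
    a<b-at (0 , 1 , 1) ∷ᶜ
    a<b-at (0 , 0 , 2) ∷ᶜ
    end (below 0 0 3 (≤-by 3b<5m (solve vars) refl))

  heavy-chain′ : 3 * m + b < 3 * a → Chain (4 * m) (5 * m) (map val heavyTriples′)
  heavy-chain′ 3m+b<3a =
    subst (4 * m ≤_) (sym (val-plain 4 0 0)) (≤-reflexive (solve vars)) ∷ᶜ
    3m<2a-at (1 , 0 , 0) ∷ᶜ
    a<b-at (1 , 1 , 0) ∷ᶜ
    a<b-at (1 , 0 , 1) ∷ᶜ
    2b<2m+a-at (1 , 0 , 0) ∷ᶜ
    a<b-at (3 , 0 , 0) ∷ᶜ
    compare-plain 3 0 1 0 3 0 (≤-by 3m+b<3a (solve vars) (solve vars)) ∷ᶜ
    a<b-at (0 , 2 , 0) ∷ᶜ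
    a<b-at (0 , 1 , 1) ∷ᶜ
    a<b-at (0 , 0 , 2) ∷ᶜ
    end (below 0 0 3 (≤-by 3b<5m (solve vars) refl))

  generator-chain : Chain 1 (2 * m) (map val generatorTriples)
  generator-chain =
    0<m-at (0 , 0 , 0) ∷ᶜ
    m<a-at (0 , 0 , 0) ∷ᶜ
    a<b-at (0 , 0 , 0) ∷ᶜ
    end (below 0 0 1 (≤-by b<2m (solve vars) refl))

  ∈-values⁻ : ∀ us {z} → z ∈ map val us → Σ Triple λ u → u ∈ us × z ≡ val u
  ∈-values⁻ us = ∈-map⁻ val {xs = us}

  values∈S : ∀ us {z} → z ∈ map val us → T (S z)
  values∈S us z∈ with u , _ , refl ← ∈-values⁻ us z∈ = mem-generated gens (4 * m) (val-generated u)

  0<4m : 0 < 4 * m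
  0<4m = ≤-trans 0<m (m≤m+n m (3 * m))

  4m-1<4m : 4 * m ∸ 1 < 4 * m
  4m-1<4m = ∸-monoʳ-< {4 * m} {1} {0} (s≤s z≤n) 0<4m

  2m≤4m : 2 * m ≤ 4 * m
  2m≤4m = *-monoˡ-≤ m {2} {4} (s≤s (s≤s z≤n))

  low<4m : ∀ {z} → z ∈ map val lowTriples → z < 4 * m
  low<4m z∈ = <-trans (proj₂ (chain-bounds low-chain z∈)) 4m-1<4m

  L-complete : ∀ {z} → z < 4 * m → T (S z) → z ∈ map val lowTriples
  L-complete z<4m z∈S with u , val≡z ← S-below-4m z<4m z∈S =
    subst (_∈ map val lowTriples) val≡z (∈-map⁺ val (light-complete u
      (s≤s⁻¹ (weight-bound u 4 (subst (_< 4 * m) (sym val≡z) z<4m)))))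

  conductor≡4m : conductor gens (4 * m) ≡ 4 * m
  conductor≡4m = conductor-of gens (4 * m) 0<4m
    (λ 4m-1∈S → <-irrefl refl (proj₂ (chain-bounds low-chain (L-complete 4m-1<4m 4m-1∈S))))

  multiplicity≡m : multiplicity gens (4 * m) ≡ m
  multiplicity≡m = multSearch-first S* (4 * m) 1 m 0<m (s≤s (m≤m+n m (3 * m)))
    (λ i _ i<m → ¬T⇒≡false (λ i∈S* → <-irrefl refl (<-≤-trans i<m (S*-≥m i∈S*))))
    (Equivalence.to T-≡ (subst (T ∘ S*) val100≡m (val∈S* (1 , 0 , 0) (s≤s z≤n))))
    where
    val100≡m : val (1 , 0 , 0) ≡ m
    val100≡m = trans (val-plain 1 0 0) (trans (+-identityʳ (1 * m)) (*-identityˡ m))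

  count-L : length (filter (T? ∘ S) (upTo (4 * m))) ≡ 13
  count-L = cong length (filter-increasing (T? ∘ S) (upTo-increasing (4 * m)) (chain-increasing low-chain)
    (λ z∈ z∈S → L-complete (∈-upTo⁻ z∈) z∈S)
    (λ z∈ → ∈-upTo⁺ (low<4m z∈) , values∈S lowTriples z∈))

  indecomposable-degree : ∀ u → T (S* (val u)) → ¬ T (D (val u)) → degree u ≡ 1
  indecomposable-degree u u∈S* u∉D =
    ≤-antisym (s≤s⁻¹ (≰⇒> (u∉D ∘ degree≥2⇒D u)))
      (positive-degree u (proj₁ (mem*-elim gens (4 * m) u∈S*)))

  primitive⇒generator : ∀ {z} → z < 4 * m → T (Prim z) → z ∈ map val generatorTriples
  primitive⇒generator {z} z<4m z∈P =
    let z∈S* , z∉D = Equivalence.to (T-∧ {S* z} {not (D z)}) z∈P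
        u , u∈low , z≡val = ∈-values⁻ lowTriples (L-complete z<4m (proj₂ (mem*-elim gens (4 * m) z∈S*)))
        u∉D = λ u∈D → subst T (Equivalence.to T-not-≡ z∉D) (subst (T ∘ D) (sym z≡val) u∈D)
    in subst (_∈ map val generatorTriples) (sym z≡val) (∈-map⁺ val
         (All.lookup light-generators u∈low (indecomposable-degree u (subst (T ∘ S*) z≡val z∈S*) u∉D)))

  -- The generators are primitive: they lie below 2m, while D lies above.
  generator⇒primitive : ∀ {z} → z ∈ map val generatorTriples → T (Prim z)
  generator⇒primitive {z} z∈ =
    let 1≤z , z<2m = chain-bounds generator-chain z∈ in
    Equivalence.from (T-∧ {S* z} {not (D z)}) (mem*-intro gens (4 * m) 1≤z (values∈S generatorTriples z∈) ,
      Equivalence.from T-not-≡ (¬T⇒≡false (λ z∈D → <-irrefl refl (<-≤-trans z<2m (D-≥2m z∈D)))))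

  count-PL : length (filter (T? ∘ Prim) (filter (T? ∘ S) (upTo (4 * m)))) ≡ 3
  count-PL = cong length (filter-increasing (T? ∘ Prim)
    (AllPairs.filter⁺ (T? ∘ S) (upTo-increasing (4 * m))) (chain-increasing generator-chain)
    (λ z∈ z∈P → primitive⇒generator (∈-upTo⁻ (proj₁ (∈-filter⁻ (T? ∘ S) z∈))) z∈P)
    (λ z∈ → ∈-filter⁺ (T? ∘ S)
                (∈-upTo⁺ (<-≤-trans (proj₂ (chain-bounds generator-chain z∈)) 2m≤4m))
                (values∈S generatorTriples z∈) ,
              generator⇒primitive z∈))

  4m+m≡5m : 4 * m + m ≡ 5 * m
  4m+m≡5m = solve vars

  summand<4m : ∀ {s r z} → m ≤ r → s + r ≡ z → z < 4 * m + m → s < 4 * m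
  summand<4m {s} m≤r s+r≡z z<5m =
    +-cancelʳ-< m s (4 * m) (≤-<-trans (+-monoʳ s m≤r) (subst (_< 4 * m + m) (sym s+r≡z) z<5m))

  heavy-of : ∀ w → 4 * m ≤ val w → val w < 4 * m + m → w ∈ heavyTriples
  heavy-of w 4m≤val val<5m =
    [ (λ light → ⊥-elim (<-irrefl refl (<-≤-trans (low<4m (∈-map⁺ val light)) 4m≤val)))
    , (λ heavy → heavy)
    ]′
      (light-or-heavy w (s≤s⁻¹ (weight-bound w 5 (subst (val w <_) 4m+m≡5m val<5m))))

  -- An element of D in [4m, 5m) is a sum x + y of elements x, y ∈ S* below 4m,
  -- hence the value of a triple, which must be heavy.
  Dq-heavy : ∀ {z} → 4 * m ≤ z → z < 4 * m + m → T (D z) →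
    Σ Triple λ w → w ∈ heavyTriples × val w ≡ z
  Dq-heavy {z} 4m≤z z<5m z∈D =
    let x , y , x∈S* , y∈S* , x+y≡z = inD-sound gens (4 * m) z∈D
        u , val≡x = S-below-4m (summand<4m (S*-≥m y∈S*) x+y≡z z<5m) (proj₂ (mem*-elim gens (4 * m) x∈S*))
        v , val≡y = S-below-4m (summand<4m (S*-≥m x∈S*) (trans (+-comm y x) x+y≡z) z<5m)
                      (proj₂ (mem*-elim gens (4 * m) y∈S*))
        val≡z = trans (sym (val-⊕ u v)) (trans (cong₂ _+_ val≡x val≡y) x+y≡z)
    in u ⊕ v ,
       heavy-of (u ⊕ v) (subst (4 * m ≤_) (sym val≡z) 4m≤z) (subst (_< 4 * m + m) (sym val≡z) z<5m) ,
       val≡z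

  Dq-values : ∀ {E} → heavyTriples ↭ E → Chain (4 * m) (5 * m) (map val E) →
    filter (T? ∘ D) (range (4 * m) m) ≡ map val E
  Dq-values {E} heavy↭E chain = filter-increasing (T? ∘ D) (range-increasing (4 * m) m) (chain-increasing chain)
    (λ z∈ z∈D → let 4m≤z , z<5m = ∈-range⁻ z∈ ; u , u∈heavy , val≡z = Dq-heavy 4m≤z z<5m z∈D in
      subst (_∈ map val E) val≡z (∈-map⁺ val (∈-resp-↭ heavy↭E u∈heavy)))
    (λ z∈ → let 4m≤z , z<5m = chain-bounds chain z∈ ; u , u∈E , z≡val = ∈-values⁻ E z∈ in
      ∈-range⁺ 4m≤z (subst₂ _<_ refl (sym 4m+m≡5m) z<5m) ,
      subst (T ∘ D) (sym z≡val)
        (degree≥2⇒D u (All.lookup heavy-degree (∈-resp-↭ (↭-sym heavy↭E) u∈E))))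

  count-Dq : 3 * a ≢ 3 * m + b → length (filter (T? ∘ D) (range (4 * m) m)) ≡ 10
  count-Dq 3a≢3m+b with <-cmp (3 * a) (3 * m + b)
  ... | tri< 3a<3m+b _ _ = cong length (Dq-values ↭-refl (heavy-chain 3a<3m+b))
  ... | tri≈ _ 3a≡3m+b _ = ⊥-elim (3a≢3m+b 3a≡3m+b)
  ... | tri> _ _ 3m+b<3a = cong length (Dq-values heavy↭heavy′ (heavy-chain′ 3m+b<3a))

3a≢3m+b : (m a b : ℕ) → .{{_ : NonZero m}} →
  Unique (map (λ x → x % m)
    (a ∷ b ∷ 2 * a ∷ a + b ∷ 2 * b ∷ 3 * a ∷ 2 * a + b ∷ a + 2 * b ∷ 3 * b ∷ [])) →
  3 * a ≢ 3 * m + b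
3a≢3m+b m a b (_ ∷ᴾ (_ ∷ᴬ _ ∷ᴬ _ ∷ᴬ b≢3a ∷ᴬ _) ∷ᴾ _) 3a≡3m+b = b≢3a (sym (begin
  3 * a % m        ≡⟨ cong (_% m) 3a≡3m+b ⟩
  (3 * m + b) % m  ≡⟨ cong (_% m) (+-comm (3 * m) b) ⟩
  (b + 3 * m) % m  ≡⟨ [m+kn]%n≡m%n b 3 m ⟩
  b % m            ∎))
  where open ≡-Reasoning

proposition3p1 : (m a b : ℕ) → .{{_ : NonZero m}} → 0 < a → 0 < b →
    3 * m + 1 ≤ 2 * a → a < b → 3 * b + 1 ≤ 5 * m →
    Unique (map (λ x → x % m)
      (a ∷ b ∷ 2 * a ∷ a + b ∷ 2 * b ∷ 3 * a ∷ 2 * a + b ∷ a + 2 * b ∷ 3 * b ∷ [])) →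
    W0 (m ∷ a ∷ b ∷ []) (4 * m) ≡ -[1+ 0 ]
proposition3p1 m a b _ _ 3m<2a a<b 3b<5m distinct = begin
  W0 gens (4 * m)
    ≡⟨ W0-from-counts gens (4 * m) conductor≡4m multiplicity≡m count-PL count-L
         (count-Dq (3a≢3m+b m a b distinct)) ⟩
  (⁺ (3 * 13) - ⁺ (ceilDiv (4 * m) m * 10)) ℤ.+ ⁺ (ceilDiv (4 * m) m * m ∸ 4 * m)
    ≡⟨ cong (λ q → (⁺ 39 - ⁺ (q * 10)) ℤ.+ ⁺ (q * m ∸ 4 * m)) (ceilDiv-multiple 4 m) ⟩
  (⁺ 39 - ⁺ 40) ℤ.+ ⁺ (4 * m ∸ 4 * m)
    ≡⟨ cong (λ ρ → (⁺ 39 - ⁺ 40) ℤ.+ ⁺ ρ) (n∸n≡0 (4 * m)) ⟩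
  -[1+ 0 ]
    ∎
  where
  open ≡-Reasoning
  open Semigroup m a b 3m<2a a<b 3b<5m
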